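{- Let $K,L$ be fields, $n\ge1$, and let $\mathcal L=\mathcal L_{\mathrm{ri}}\cup\{f\}$ with $f$ a unary function symbol. Consider the $\mathcal L$-structures $(M_n(K),\mathrm{tr}_K)$ and $(M_n(L),\mathrm{tr}_L)$. Let $(U,f)$ be an $\mathcal L$-structure and let $\phi:(U,f)\to(M_n(K),\mathrm{tr}_K)$ and $\psi:(U,f)\to(M_n(L),\mathrm{tr}_L)$ be $\mathcal L$-embeddings. Then: (1) The subring $R$ of $U$ generated by the image $f(U)$ is commutative, $\phi(R)\subseteq K\cdot I_n$ and $\psi(R)\subseteq L\cdot I_n$. (2) Suppose $\Omega$ is a field and $\varepsilon:K\cdot I_n\to\Omega\cdot I_n$, $\delta:L\cdot I_n\to\Omega\cdot I_n$ are field embeddings with $\varepsilon\circ\phi|_R=\delta\circ\psi|_R$. Let $\bar\varepsilon:M_n(K)\to M_n(\Omega)$ and $\bar\delta:M_n(L)\to M_n(\Omega)$ be the induced maps (applying $\varepsilon$, resp. $\delta$, to each entry, identifying $K\cdot I_n$ with $K$, etc.). Then for every $X\in U$, $\mathrm{tr}_\Omega(\bar\varepsilon(\phi(X)))=\mathrm{tr}_\Omega(\bar\delta(\psi(X)))$.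
   Context: $\mathcal L_{\mathrm{ri}}=\{+,\cdot,-,0,1\}$ is the language of unital rings. For a field $K$, $\mathrm{tr}_K:M_n(K)\to M_n(K)$ denotes $X\mapsto \mathrm{tr}(X)\cdot I_n$, i.e. the trace taking values in the center $K\cdot I_n$. -}

module Defs where

open import Level using (Level; _⊔_; suc)
open import Algebra.Bundles using (CommutativeRing)
open import Data.Nat using (ℕ)
open import Data.Fin using (Fin)
open import Data.Product using (Σ; ∃; _×_)
open import Relation.Nullary using (¬_)
open import Relation.Binary.PropositionalEquality using (_≡_)

record Field (c ℓ : Level) : Set (suc (c ⊔ ℓ)) where
  field
    commutativeRing : CommutativeRing c ℓ
  open CommutativeRing commutativeRing public
  field
    1≉0     : ¬ (1# ≈ 0#)
    inverse : ∀ x → ¬ (x ≈ 0#) → Σ Carrier (λ y → (x * y) ≈ 1#)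

module Matrices {c ℓ} (K : Field c ℓ) where
  open Field K
  open import Algebra.Definitions.RawMonoid +-rawMonoid using (sum)

  Mat : ℕ → Set c
  Mat n = Fin n → Fin n → Carrier

  _≈M_ : ∀ {n} → Mat n → Mat n → Set ℓ
  A ≈M B = ∀ i j → A i j ≈ B i j

  _+M_ : ∀ {n} → Mat n → Mat n → Mat n
  (A +M B) i j = A i j + B i j

  _*M_ : ∀ {n} → Mat n → Mat n → Mat n
  (A *M B) i j = sum (λ k → A i k * B k j)

  -M_ : ∀ {n} → Mat n → Mat n
  (-M A) i j = - (A i j)

  scalar : ∀ {n} → Carrier → Mat n
  scalar a i j with i Data.Fin.≟ j
  ... | Relation.Nullary.yes _ = a
  ... | Relation.Nullary.no  _ = 0#

  0M 1M : ∀ {n} → Mat n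
  0M = scalar 0#
  1M = scalar 1#

  tr : ∀ {n} → Mat n → Carrier
  tr A = sum (λ i → A i i)

  trK : ∀ {n} → Mat n → Mat n
  trK A = scalar (tr A)

-- An L-structure for L = L_ri ∪ {f}: a set with +, ·, -, 0, 1 and a unary f.
-- Equality on U is genuine (propositional) equality.
record LStructure (u : Level) : Set (suc u) where
  field
    U   : Set u
    _⊕_ : U → U → U
    _⊗_ : U → U → U
    ⊖_  : U → U
    𝟘 𝟙 : U
    f   : U → U

record Embedding {u c ℓ} (S : LStructure u) (K : Field c ℓ) (n : ℕ)
                 : Set (u ⊔ c ⊔ ℓ) where
  open LStructure S
  open Matrices K
  field
    map     : U → Mat n
    inj     : ∀ x y → map x ≈M map y → x ≡ y
    pres-+  : ∀ x y → map (x ⊕ y) ≈M (map x +M map y)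
    pres-*  : ∀ x y → map (x ⊗ y) ≈M (map x *M map y)
    pres--  : ∀ x → map (⊖ x) ≈M (-M map x)
    pres-0  : map 𝟘 ≈M 0M
    pres-1  : map 𝟙 ≈M 1M
    pres-f  : ∀ x → map (f x) ≈M trK (map x)

module _ {u} (S : LStructure u) where
  open LStructure S
  data InR : U → Set u where
    gen  : ∀ x → InR (f x)
    zer  : InR 𝟘
    one  : InR 𝟙
    add  : ∀ {a b} → InR a → InR b → InR (a ⊕ b)
    mul  : ∀ {a b} → InR a → InR b → InR (a ⊗ b)
    neg  : ∀ {a} → InR a → InR (⊖ a)

record FieldEmbedding {a b c d} (K : Field a b) (Ω : Field c d) : Set (a ⊔ b ⊔ c ⊔ d) where
  private
    module K = Field K
    module Ω = Field Ω
  field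
    map    : K.Carrier → Ω.Carrier
    cong   : ∀ {x y} → x K.≈ y → map x Ω.≈ map y
    inj    : ∀ {x y} → map x Ω.≈ map y → x K.≈ y
    pres-+ : ∀ x y → map (x K.+ y) Ω.≈ (map x Ω.+ map y)
    pres-* : ∀ x y → map (x K.* y) Ω.≈ (map x Ω.* map y)
    pres-- : ∀ x → map (K.- x) Ω.≈ (Ω.- map x)
    pres-0 : map K.0# Ω.≈ Ω.0#
    pres-1 : map K.1# Ω.≈ Ω.1#

liftMat : ∀ {a b c d} {K : Field a b} {Ω : Field c d} {n : ℕ} →
          FieldEmbedding K Ω → Matrices.Mat K n → Matrices.Mat Ω n
liftMat ε A i j = FieldEmbedding.map ε (A i j)

-- Since φ(f x) = tr(φ x)·Iₙ and an embedding preserves the ring operations, φ maps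
-- the subring generated by f(U) into the scalar matrices, which commute; injectivity
-- of φ transports commutativity back to U. For (2), the scalar tr(φ X) is an entry of
-- φ(f X) and f X ∈ R, so ε(tr φ X) = δ(tr ψ X), and the trace commutes with field
-- embeddings applied entrywise.
module Submission where

open import Defs
open import Level using (Level)
open import Data.Nat using (ℕ; _≥_; suc)
open import Data.Fin using (Fin; _≟_; punchIn)
open import Data.Fin.Properties using (punchInᵢ≢i)
open import Data.Product using (Σ; _×_; _,_)
open import Data.Vec.Functional using (Vector; replicate; tail)
open import Relation.Binary.PropositionalEquality using (_≡_; _≢_)
import Relation.Binary.PropositionalEquality as ≡
open import Relation.Nullary using (yes; no; contradiction)
import Algebra.Properties.Ring as RingProperties
import Algebra.Properties.Semiring.Sum as SemiringSum
import Relation.Binary.Reasoning.Setoid as SetoidReasoning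

module ScalarMatrices {c ℓ} (K : Field c ℓ) where
  open Field K
  open Matrices K
  open SemiringSum semiring using (sum; sum-cong-≋; sum-remove; sum-replicate-zero)
  open RingProperties ring using (-0#≈0#)
  open SetoidReasoning setoid

  ≈M-sym : ∀ {n} {A B : Mat n} → A ≈M B → B ≈M A
  ≈M-sym A≈B i j = sym (A≈B i j)

  ≈M-trans : ∀ {n} {A B C : Mat n} → A ≈M B → B ≈M C → A ≈M C
  ≈M-trans A≈B B≈C i j = trans (A≈B i j) (B≈C i j)

  +M-cong : ∀ {n} {A A′ B B′ : Mat n} → A ≈M A′ → B ≈M B′ → (A +M B) ≈M (A′ +M B′)
  +M-cong A≈A′ B≈B′ i j = +-cong (A≈A′ i j) (B≈B′ i j)

  *M-cong : ∀ {n} {A A′ B B′ : Mat n} → A ≈M A′ → B ≈M B′ → (A *M B) ≈M (A′ *M B′)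
  *M-cong A≈A′ B≈B′ i j = sum-cong-≋ (λ k → *-cong (A≈A′ i k) (B≈B′ k j))

  -M-cong : ∀ {n} {A B : Mat n} → A ≈M B → (-M A) ≈M (-M B)
  -M-cong A≈B i j = -‿cong (A≈B i j)

  sum-single : ∀ {n} {i : Fin n} (t : Vector Carrier n) →
               (∀ k → k ≢ i → t k ≈ 0#) → sum t ≈ t i
  sum-single {suc n} {i} t vanishes = begin
    sum t                                 ≈⟨ sum-remove t ⟩
    t i + sum (λ k → t (punchIn i k))     ≈⟨ +-congˡ (sum-cong-≋ (λ k → vanishes _ (punchInᵢ≢i i k))) ⟩
    t i + sum (replicate n 0#)            ≈⟨ +-congˡ (sum-replicate-zero n) ⟩
    t i + 0#                              ≈⟨ +-identityʳ (t i) ⟩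
    t i                                   ∎

  scalar-diagonal : ∀ {n} a (i : Fin n) → scalar a i i ≈ a
  scalar-diagonal a i with i ≟ i
  ... | yes _   = refl
  ... | no i≢i = contradiction ≡.refl i≢i

  scalar-offDiagonal : ∀ {n} a {i j : Fin n} → i ≢ j → scalar a i j ≈ 0#
  scalar-offDiagonal a {i} {j} i≢j with i ≟ j
  ... | yes i≡j = contradiction i≡j i≢j
  ... | no _    = refl

  scalar-cong : ∀ {n} {a b} → a ≈ b → scalar {n} a ≈M scalar b
  scalar-cong a≈b i j with i ≟ j
  ... | yes _ = a≈b
  ... | no _  = refl

  scalar-+ : ∀ {n} a b → (scalar {n} a +M scalar b) ≈M scalar (a + b)
  scalar-+ a b i j with i ≟ j
  ... | yes _ = refl
  ... | no _  = +-identityˡ 0#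

  -M-scalar : ∀ {n} a → (-M scalar {n} a) ≈M scalar (- a)
  -M-scalar a i j with i ≟ j
  ... | yes _ = refl
  ... | no _  = -0#≈0#

  *-scalar : ∀ {n} a b (i j : Fin n) → a * scalar b i j ≈ scalar (a * b) i j
  *-scalar a b i j with i ≟ j
  ... | yes _ = refl
  ... | no _  = zeroʳ a

  scalar-* : ∀ {n} a b → (scalar {n} a *M scalar b) ≈M scalar (a * b)
  scalar-* a b i j = begin
    sum (λ k → scalar a i k * scalar b k j)
      ≈⟨ sum-single {i = i} (λ k → scalar a i k * scalar b k j) (λ k k≢i → trans (*-congʳ (scalar-offDiagonal a (λ i≡k → k≢i (≡.sym i≡k)))) (zeroˡ _)) ⟩
    scalar a i i * scalar b i j   ≈⟨ *-congʳ (scalar-diagonal a i) ⟩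
    a * scalar b i j              ≈⟨ *-scalar a b i j ⟩
    scalar (a * b) i j            ∎

module _ {a b c d} {K : Field a b} {Ω : Field c d} (ε : FieldEmbedding K Ω) where
  private
    module K = Field K
  open Field Ω
  open FieldEmbedding ε
  open SemiringSum semiring using (sum)
  open SemiringSum K.semiring using () renaming (sum to sumK)

  map-sum : ∀ {n} (t : Vector K.Carrier n) → sum (λ k → map (t k)) ≈ map (sumK t)
  map-sum {0}     t = sym pres-0
  map-sum {suc n} t = trans (+-congˡ (map-sum (tail t))) (sym (pres-+ _ _))

module _ {u c ℓ} {S : LStructure u} {K : Field c ℓ} {n : ℕ} (φ : Embedding S K n) where
  open LStructure S
  open Field K
  open Matrices K
  open Embedding φ
  open ScalarMatrices K

  map-⊗-scalar : ∀ {a b ca cb} → map a ≈M scalar ca → map b ≈M scalar cb →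
                 map (a ⊗ b) ≈M scalar (ca * cb)
  map-⊗-scalar φa≈ φb≈ = ≈M-trans (pres-* _ _) (≈M-trans (*M-cong φa≈ φb≈) (scalar-* _ _))

  InR⇒map-scalar : ∀ {a} → InR S a → Σ Carrier (λ ca → map a ≈M scalar ca)
  InR⇒map-scalar (gen x) = tr (map x) , pres-f x
  InR⇒map-scalar zer     = 0# , pres-0
  InR⇒map-scalar one     = 1# , pres-1
  InR⇒map-scalar (add ra rb) with InR⇒map-scalar ra | InR⇒map-scalar rb
  ... | ca , φa≈ | cb , φb≈ =
    ca + cb , ≈M-trans (pres-+ _ _) (≈M-trans (+M-cong φa≈ φb≈) (scalar-+ ca cb))
  InR⇒map-scalar (mul ra rb) with InR⇒map-scalar ra | InR⇒map-scalar rb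
  ... | ca , φa≈ | cb , φb≈ = ca * cb , map-⊗-scalar φa≈ φb≈
  InR⇒map-scalar (neg ra) with InR⇒map-scalar ra
  ... | ca , φa≈ = - ca , ≈M-trans (pres-- _) (≈M-trans (-M-cong φa≈) (-M-scalar ca))

  InR-⊗-comm : ∀ {a b} → InR S a → InR S b → a ⊗ b ≡ b ⊗ a
  InR-⊗-comm ra rb with InR⇒map-scalar ra | InR⇒map-scalar rb
  ... | ca , φa≈ | cb , φb≈ = inj _ _
    (≈M-trans (map-⊗-scalar φa≈ φb≈)
      (≈M-trans (scalar-cong (*-comm ca cb)) (≈M-sym (map-⊗-scalar φb≈ φa≈))))

  map-f-diagonal : ∀ x (i : Fin n) → map (f x) i i ≈ tr (map x)
  map-f-diagonal x i = trans (pres-f x i i) (scalar-diagonal _ i)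

module _ {u k₁ k₂ l₁ l₂ o₁ o₂} {S : LStructure u} {K : Field k₁ k₂} {L : Field l₁ l₂}
         {Ω : Field o₁ o₂} {n : ℕ} (φ : Embedding S K n) (ψ : Embedding S L n)
         (ε : FieldEmbedding K Ω) (δ : FieldEmbedding L Ω) where
  open LStructure S using (f)
  open Field Ω using (setoid)
  open Matrices Ω using (tr; trK; _≈M_)
  open SetoidReasoning setoid
  private
    module φ = Embedding φ
    module ψ = Embedding ψ
    module ε = FieldEmbedding ε
    module δ = FieldEmbedding δ

  -- The trace of X is recorded on the diagonal of φ(f X), so agreement on f(U) suffices.
  trK-liftMat-agree : (∀ x → liftMat ε (φ.map (f x)) ≈M liftMat δ (ψ.map (f x))) →
                      ∀ X → trK (liftMat ε (φ.map X)) ≈M trK (liftMat δ (ψ.map X))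
  trK-liftMat-agree agree X i = ScalarMatrices.scalar-cong Ω (begin
    tr (liftMat ε (φ.map X))             ≈⟨ map-sum ε (λ k → φ.map X k k) ⟩
    ε.map (Matrices.tr K (φ.map X))      ≈⟨ ε.cong (Field.sym K (map-f-diagonal φ X i)) ⟩
    ε.map (φ.map (f X) i i)              ≈⟨ agree X i i ⟩
    δ.map (ψ.map (f X) i i)              ≈⟨ δ.cong (map-f-diagonal ψ X i) ⟩
    δ.map (Matrices.tr L (ψ.map X))      ≈⟨ map-sum δ (λ k → ψ.map X k k) ⟨
    tr (liftMat δ (ψ.map X))             ∎) i

lemma2p2p1 : ∀ {k₁ k₂ l₁ l₂ u o₁ o₂ : Level} (K : Field k₁ k₂) (L : Field l₁ l₂) (n : ℕ) → n ≥ 1 →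
    (S : LStructure u) (φ : Embedding S K n) (ψ : Embedding S L n) →
    -- (1)
    ((∀ a b → InR S a → InR S b →
        LStructure._⊗_ S a b ≡ LStructure._⊗_ S b a)
     × (∀ a → InR S a → Σ (Field.Carrier K) (λ c →
          Matrices._≈M_ K (Embedding.map φ a) (Matrices.scalar K c)))
     × (∀ a → InR S a → Σ (Field.Carrier L) (λ c →
          Matrices._≈M_ L (Embedding.map ψ a) (Matrices.scalar L c))))
    ×
    -- (2)
    (∀ (Ω : Field o₁ o₂) (ε : FieldEmbedding K Ω) (δ : FieldEmbedding L Ω) →
      (∀ a → InR S a →
        Matrices._≈M_ Ω (liftMat ε (Embedding.map φ a)) (liftMat δ (Embedding.map ψ a))) →
      ∀ X → Matrices._≈M_ Ω (Matrices.trK Ω (liftMat ε (Embedding.map φ X)))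
                            (Matrices.trK Ω (liftMat δ (Embedding.map ψ X))))
-- The hypothesis n ≥ 1 is not needed: an entry index already inhabits Fin n.
lemma2p2p1 K L n _ S φ ψ =
  ( (λ _ _ → InR-⊗-comm φ)
  , (λ _ → InR⇒map-scalar φ)
  , (λ _ → InR⇒map-scalar ψ) )
  , λ Ω ε δ agree → trK-liftMat-agree φ ψ ε δ (λ x → agree (LStructure.f S x) (gen x))
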